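{- Let $(U,\mathcal{A},\lambda)$ be a reflexive object in a Cartesian closed differential category, i.e. $\mathcal{A}:U\to[U\Rightarrow U]$ and $\lambda:[U\Rightarrow U]\to U$ with $\mathcal{A}\circ\lambda=\mathrm{Id}_{[U\Rightarrow U]}$. (i) If $\mathcal{A}$ and $\lambda\circ\mathcal{A}$ are linear, then both $\mathcal{A}$ and $\lambda$ are linear. (ii) If moreover $\lambda\circ\mathcal{A}=\mathrm{Id}_U$ (the object is extensional) and either $\mathcal{A}$ or $\lambda$ is linear, then both $\mathcal{A}$ and $\lambda$ are linear.
   Context: Cartesian closed differential category: a category whose homsets are commutative monoids $(+,0)$ with $(g+h)\circ f=g\circ f+h\circ f$, $0\circ f=0$; with finite products in which projections are additive and pairings of additive maps are additive; with an operator $D$, $f:A\to B\mapsto D(f):A\times A\to B$, satisfying (D1) $D(f+g)=D(f)+D(g)$, $D(0)=0$; (D2) $D(f)\circ\langle h+k,v\rangle=D(f)\circ\langle h,v\rangle+D(f)\circ\langle k,v\rangle$, $D(f)\circ\langle0,v\rangle=0$; (D3) $D(\mathrm{Id})=\pi_1$, $D(\pi_1)=\pi_1\circ\pi_1$, $D(\pi_2)=\pi_2\circ\pi_1$; (D4) $D\langle f,g\rangle=\langle D(f),D(g)\rangle$; (D5) $D(f\circ g)=D(f)\circ\langle D(g),g\circ\pi_2\rangle$; (D6) $D(D(f))\circ\langle\langle g,0\rangle,\langle h,k\rangle\rangle=D(f)\circ\langle g,k\rangle$; (D7) $D(D(f))\circ\langle\langle0,h\rangle,\langle g,k\rangle\rangle=D(D(f))\circ\langle\langle0,g\rangle,\langle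 h,k\rangle\rangle$; Cartesian closed with $\Lambda(f+g)=\Lambda f+\Lambda g$, $\Lambda(0)=0$, $D(\Lambda f)=\Lambda(D(f)\circ\langle\pi_1\times0_A,\pi_2\times\mathrm{Id}_A\rangle)$. A morphism $f$ is linear if $D(f)=f\circ\pi_1$. -}

module Defs where

open import Level using (Level; _⊔_) renaming (suc to lsuc)
open import Relation.Binary.PropositionalEquality using (_≡_)
open import Data.Product using (_×_)

record LeftAdditiveCartesian (o ℓ : Level) : Set (lsuc (o ⊔ ℓ)) where
  infixr 9 _∘_
  infixl 6 _+_
  infixr 7 _⊗_
  field
    Obj : Set o
    Hom : Obj → Obj → Set ℓ
    id  : ∀ {A} → Hom A A
    _∘_ : ∀ {A B C} → Hom B C → Hom A B → Hom A C
    assoc : ∀ {A B C E} {f : Hom A B} {g : Hom B C} {h : Hom C E} →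
            (h ∘ g) ∘ f ≡ h ∘ (g ∘ f)
    identityˡ : ∀ {A B} {f : Hom A B} → id ∘ f ≡ f
    identityʳ : ∀ {A B} {f : Hom A B} → f ∘ id ≡ f
    _+_ : ∀ {A B} → Hom A B → Hom A B → Hom A B
    0h  : ∀ {A B} → Hom A B
    +-assoc : ∀ {A B} (f g h : Hom A B) → (f + g) + h ≡ f + (g + h)
    +-comm  : ∀ {A B} (f g : Hom A B) → f + g ≡ g + f
    +-identityˡ : ∀ {A B} (f : Hom A B) → 0h + f ≡ f
    +-∘ : ∀ {A B C} (g h : Hom B C) (f : Hom A B) → (g + h) ∘ f ≡ g ∘ f + h ∘ f
    0-∘ : ∀ {A B C} (f : Hom A B) → 0h {B} {C} ∘ f ≡ 0h
    ⊤ : Obj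
    ! : ∀ {A} → Hom A ⊤
    !-unique : ∀ {A} (f : Hom A ⊤) → f ≡ !
    _⊗_ : Obj → Obj → Obj
    π₁ : ∀ {A B} → Hom (A ⊗ B) A
    π₂ : ∀ {A B} → Hom (A ⊗ B) B
    ⟨_,_⟩ : ∀ {C A B} → Hom C A → Hom C B → Hom C (A ⊗ B)
    π₁-β : ∀ {C A B} {f : Hom C A} {g : Hom C B} → π₁ ∘ ⟨ f , g ⟩ ≡ f
    π₂-β : ∀ {C A B} {f : Hom C A} {g : Hom C B} → π₂ ∘ ⟨ f , g ⟩ ≡ g
    ⟨⟩-unique : ∀ {C A B} {f : Hom C A} {g : Hom C B} (h : Hom C (A ⊗ B)) →
                π₁ ∘ h ≡ f → π₂ ∘ h ≡ g → h ≡ ⟨ f , g ⟩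

  IsAdditive : ∀ {A B} → Hom A B → Set (o ⊔ ℓ)
  IsAdditive {A} f = (∀ {X} (u v : Hom X A) → f ∘ (u + v) ≡ f ∘ u + f ∘ v)
                   × (∀ {X} → f ∘ 0h {X} ≡ 0h)

  _×₁_ : ∀ {A B C E} → Hom A B → Hom C E → Hom (A ⊗ C) (B ⊗ E)
  f ×₁ g = ⟨ f ∘ π₁ , g ∘ π₂ ⟩

record LeftAdditiveCartesianLaws {o ℓ} (B : LeftAdditiveCartesian o ℓ) : Set (o ⊔ ℓ) where
  open LeftAdditiveCartesian B
  field
    π₁-additive : ∀ {A C} → IsAdditive (π₁ {A} {C})
    π₂-additive : ∀ {A C} → IsAdditive (π₂ {A} {C})
    ⟨⟩-additive : ∀ {X A C} {f : Hom X A} {g : Hom X C} →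
                  IsAdditive f → IsAdditive g → IsAdditive ⟨ f , g ⟩

record CCDC (o ℓ : Level) : Set (lsuc (o ⊔ ℓ)) where
  field
    base : LeftAdditiveCartesian o ℓ
    laws : LeftAdditiveCartesianLaws base
  open LeftAdditiveCartesian base public
  open LeftAdditiveCartesianLaws laws public
  infixr 5 _⇒_
  field
    D : ∀ {A B} → Hom A B → Hom (A ⊗ A) B
    D1-+ : ∀ {A B} (f g : Hom A B) → D (f + g) ≡ D f + D g
    D1-0 : ∀ {A B} → D (0h {A} {B}) ≡ 0h
    D2-+ : ∀ {X A B} (f : Hom A B) (h k v : Hom X A) →
           D f ∘ ⟨ h + k , v ⟩ ≡ D f ∘ ⟨ h , v ⟩ + D f ∘ ⟨ k , v ⟩
    D2-0 : ∀ {X A B} (f : Hom A B) (v : Hom X A) → D f ∘ ⟨ 0h , v ⟩ ≡ 0h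
    D3-id : ∀ {A} → D (id {A}) ≡ π₁
    D3-π₁ : ∀ {A C} → D (π₁ {A} {C}) ≡ π₁ ∘ π₁
    D3-π₂ : ∀ {A C} → D (π₂ {A} {C}) ≡ π₂ ∘ π₁
    D4 : ∀ {X A C} (f : Hom X A) (g : Hom X C) → D ⟨ f , g ⟩ ≡ ⟨ D f , D g ⟩
    D5 : ∀ {A B C} (f : Hom B C) (g : Hom A B) → D (f ∘ g) ≡ D f ∘ ⟨ D g , g ∘ π₂ ⟩
    D6 : ∀ {X A B} (f : Hom A B) (g h k : Hom X A) →
         D (D f) ∘ ⟨ ⟨ g , 0h ⟩ , ⟨ h , k ⟩ ⟩ ≡ D f ∘ ⟨ g , k ⟩
    D7 : ∀ {X A B} (f : Hom A B) (g h k : Hom X A) →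
         D (D f) ∘ ⟨ ⟨ 0h , h ⟩ , ⟨ g , k ⟩ ⟩ ≡ D (D f) ∘ ⟨ ⟨ 0h , g ⟩ , ⟨ h , k ⟩ ⟩
    _⇒_ : Obj → Obj → Obj
    ev : ∀ {A B} → Hom ((A ⇒ B) ⊗ A) B
    Λ : ∀ {C A B} → Hom (C ⊗ A) B → Hom C (A ⇒ B)
    Λ-β : ∀ {C A B} (f : Hom (C ⊗ A) B) → ev ∘ (Λ f ×₁ id) ≡ f
    Λ-unique : ∀ {C A B} (f : Hom (C ⊗ A) B) (g : Hom C (A ⇒ B)) →
               ev ∘ (g ×₁ id) ≡ f → g ≡ Λ f
    Λ-+ : ∀ {C A B} (f g : Hom (C ⊗ A) B) → Λ (f + g) ≡ Λ f + Λ g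
    Λ-0 : ∀ {C A B} → Λ (0h {C ⊗ A} {B}) ≡ 0h
    D-Λ : ∀ {C A B} (f : Hom (C ⊗ A) B) →
          D (Λ f) ≡ Λ (D f ∘ ⟨ π₁ ×₁ 0h {A} {A} , π₂ ×₁ id {A} ⟩)

  Linear : ∀ {A B} → Hom A B → Set ℓ
  Linear f = D f ≡ f ∘ π₁

record ReflexiveObject {o ℓ} (𝒞 : CCDC o ℓ) : Set (o ⊔ ℓ) where
  open CCDC 𝒞
  field
    U : Obj
    𝒜 : Hom U (U ⇒ U)
    lam : Hom (U ⇒ U) U
    retraction : 𝒜 ∘ lam ≡ id

module Submission where

open import Defs
open import Data.Product using (_×_; _,_)
open import Data.Sum using (_⊎_; inj₁; inj₂)
open import Relation.Binary.PropositionalEquality using (_≡_; sym; trans; cong; cong₂; module ≡-Reasoning)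

-- If r ∘ s = id then D s = D s ∘ (r ×₁ r) ∘ (s ×₁ s), and a linear r lets the chain
-- rule (D5) turn D s ∘ (r ×₁ r) into D (s ∘ r); so linearity of s ∘ r transfers to s.
-- For an isomorphism, the chain rule applied to f ∘ g = id with f linear gives
-- f ∘ D g = π₁, and composing with g = f⁻¹ shows g is linear.

module _ {o ℓ} (𝒞 : CCDC o ℓ) where
  open CCDC 𝒞
  open ≡-Reasoning

  ⟨⟩-∘ : ∀ {X Y A B} (f : Hom Y A) (g : Hom Y B) (h : Hom X Y) →
         ⟨ f , g ⟩ ∘ h ≡ ⟨ f ∘ h , g ∘ h ⟩
  ⟨⟩-∘ f g h = ⟨⟩-unique _ (trans (sym assoc) (cong (_∘ h) π₁-β))
                           (trans (sym assoc) (cong (_∘ h) π₂-β))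

  ×₁-∘ : ∀ {A B C A′ B′ C′} (f : Hom B C) (g : Hom B′ C′) (h : Hom A B) (k : Hom A′ B′) →
         (f ×₁ g) ∘ (h ×₁ k) ≡ (f ∘ h) ×₁ (g ∘ k)
  ×₁-∘ f g h k = begin
    ⟨ f ∘ π₁ , g ∘ π₂ ⟩ ∘ (h ×₁ k)
      ≡⟨ ⟨⟩-∘ _ _ _ ⟩
    ⟨ (f ∘ π₁) ∘ (h ×₁ k) , (g ∘ π₂) ∘ (h ×₁ k) ⟩
      ≡⟨ cong₂ ⟨_,_⟩ (trans assoc (trans (cong (f ∘_) π₁-β) (sym assoc)))
                     (trans assoc (trans (cong (g ∘_) π₂-β) (sym assoc))) ⟩
    (f ∘ h) ×₁ (g ∘ k) ∎

  id×₁id : ∀ {A B} → id {A} ×₁ id {B} ≡ id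
  id×₁id = sym (⟨⟩-unique id (trans identityʳ (sym identityˡ))
                             (trans identityʳ (sym identityˡ)))

  linear-id : ∀ {A} → Linear (id {A})
  linear-id = trans D3-id (sym identityˡ)

  D-∘-linearˡ : ∀ {A B C} {f : Hom B C} (g : Hom A B) → Linear f → D (f ∘ g) ≡ f ∘ D g
  D-∘-linearˡ {f = f} g lf = begin
    D (f ∘ g)                  ≡⟨ D5 f g ⟩
    D f ∘ ⟨ D g , g ∘ π₂ ⟩     ≡⟨ cong (_∘ ⟨ D g , g ∘ π₂ ⟩) lf ⟩
    (f ∘ π₁) ∘ ⟨ D g , g ∘ π₂ ⟩ ≡⟨ assoc ⟩
    f ∘ (π₁ ∘ ⟨ D g , g ∘ π₂ ⟩) ≡⟨ cong (f ∘_) π₁-β ⟩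
    f ∘ D g                    ∎

  D-∘-linearʳ : ∀ {A B C} (f : Hom B C) {g : Hom A B} → Linear g → D (f ∘ g) ≡ D f ∘ (g ×₁ g)
  D-∘-linearʳ f {g} lg = trans (D5 f g) (cong (λ x → D f ∘ ⟨ x , g ∘ π₂ ⟩) lg)

  linear-section : ∀ {A B} {r : Hom B A} {s : Hom A B} →
                   r ∘ s ≡ id → Linear r → Linear (s ∘ r) → Linear s
  linear-section {r = r} {s} rs lr lsr = begin
    D s                                ≡⟨ sym identityʳ ⟩
    D s ∘ id                           ≡⟨ cong (D s ∘_) (sym id×₁id) ⟩
    D s ∘ (id ×₁ id)                   ≡⟨ cong (λ x → D s ∘ (x ×₁ x)) (sym rs) ⟩
    D s ∘ ((r ∘ s) ×₁ (r ∘ s))         ≡⟨ cong (D s ∘_) (sym (×₁-∘ r r s s)) ⟩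
    D s ∘ ((r ×₁ r) ∘ (s ×₁ s))        ≡⟨ sym assoc ⟩
    (D s ∘ (r ×₁ r)) ∘ (s ×₁ s)        ≡⟨ cong (_∘ (s ×₁ s)) (sym (D-∘-linearʳ s lr)) ⟩
    D (s ∘ r) ∘ (s ×₁ s)               ≡⟨ cong (_∘ (s ×₁ s)) lsr ⟩
    ((s ∘ r) ∘ π₁) ∘ (s ×₁ s)          ≡⟨ assoc ⟩
    (s ∘ r) ∘ (π₁ ∘ (s ×₁ s))          ≡⟨ cong ((s ∘ r) ∘_) π₁-β ⟩
    (s ∘ r) ∘ (s ∘ π₁)                 ≡⟨ assoc ⟩
    s ∘ (r ∘ (s ∘ π₁))                 ≡⟨ cong (s ∘_) (sym assoc) ⟩
    s ∘ ((r ∘ s) ∘ π₁)                 ≡⟨ cong (λ x → s ∘ (x ∘ π₁)) rs ⟩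
    s ∘ (id ∘ π₁)                      ≡⟨ cong (s ∘_) identityˡ ⟩
    s ∘ π₁                             ∎

  linear-inverse : ∀ {A B} {f : Hom A B} {g : Hom B A} →
                   g ∘ f ≡ id → f ∘ g ≡ id → Linear f → Linear g
  linear-inverse {f = f} {g} gf fg lf = begin
    D g              ≡⟨ sym identityˡ ⟩
    id ∘ D g         ≡⟨ cong (_∘ D g) (sym gf) ⟩
    (g ∘ f) ∘ D g    ≡⟨ assoc ⟩
    g ∘ (f ∘ D g)    ≡⟨ cong (g ∘_) (sym (D-∘-linearˡ g lf)) ⟩
    g ∘ D (f ∘ g)    ≡⟨ cong (g ∘_) (trans (cong D fg) linear-id) ⟩
    g ∘ (id ∘ π₁)    ≡⟨ cong (g ∘_) identityˡ ⟩
    g ∘ π₁           ∎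

lemma4p3 : ∀ {o ℓ} (𝒞 : CCDC o ℓ) (R : ReflexiveObject 𝒞) →
    (CCDC.Linear 𝒞 (ReflexiveObject.𝒜 R) →
       CCDC.Linear 𝒞 (CCDC._∘_ 𝒞 (ReflexiveObject.lam R) (ReflexiveObject.𝒜 R)) →
       CCDC.Linear 𝒞 (ReflexiveObject.𝒜 R) × CCDC.Linear 𝒞 (ReflexiveObject.lam R))
    × (CCDC._∘_ 𝒞 (ReflexiveObject.lam R) (ReflexiveObject.𝒜 R) ≡ CCDC.id 𝒞 →
       (CCDC.Linear 𝒞 (ReflexiveObject.𝒜 R) ⊎ CCDC.Linear 𝒞 (ReflexiveObject.lam R)) →
       CCDC.Linear 𝒞 (ReflexiveObject.𝒜 R) × CCDC.Linear 𝒞 (ReflexiveObject.lam R))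
lemma4p3 𝒞 R = reflexive , extensional
  where
  open CCDC 𝒞 using (Linear; _∘_; id)
  open ReflexiveObject R

  reflexive : Linear 𝒜 → Linear (lam ∘ 𝒜) → Linear 𝒜 × Linear lam
  reflexive l𝒜 llam𝒜 = l𝒜 , linear-section 𝒞 retraction l𝒜 llam𝒜

  extensional : lam ∘ 𝒜 ≡ id → Linear 𝒜 ⊎ Linear lam → Linear 𝒜 × Linear lam
  extensional ext (inj₁ l𝒜)   = l𝒜 , linear-inverse 𝒞 ext retraction l𝒜
  extensional ext (inj₂ llam) = linear-inverse 𝒞 retraction ext llam , llam
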